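{- Let $n$ be a positive integer, $r\in\{1,\dots,n+1\}$, and let $\{U_1,U_2\}$ be a partition of $\{1,\dots,n+2\}\setminus\{r,r+1\}$ into two non-empty sets. Then $$T^c_{CT(U_1,\{r\},U_2)}(y)=T^c_{CT(U_1\cup\{r\},\,U_2\cup\{r+1\})}(y)-T^c_{CT(U_1\cup\{r+1\},\,U_2\cup\{r\})}(y).$$
   Context: For pairwise disjoint non-empty finite sets $U_1,\dots,U_k$ of positive integers ($k\ge2$), $CT(U_1,\dots,U_k)$ is the complete tiered graph with $k$ tiers: its vertex set is $U_1\cup\dots\cup U_k$, and for $u\in U_i$, $v\in U_j$ with $i<j$, $uv$ is an edge iff $u<v$; there are no other edges (in particular no edges within a $U_i$). For a graph $G$, $T^c_G(y)=T_G(1,y)$ if $G$ is connected and $T^c_G(y)=0$ otherwise, where $T_G(x,y)$ is the Tutte polynomial of $G$. -}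

module Defs where

open import Data.Bool using (Bool; true; false; _∧_; _∨_; not; if_then_else_)
open import Data.Nat using (ℕ; zero; suc; _∸_; _≡ᵇ_; _<ᵇ_)
open import Data.Integer as ℤ using (ℤ; +_; _^_)
open import Data.List using (List; []; _∷_; _++_; map; foldr; filter; length; concat; concatMap)
open import Data.Bool.ListAction using (any)
open import Data.Product using (_×_; _,_)
open import Relation.Nullary.Decidable using (Dec)
open import Relation.Binary.PropositionalEquality using (_≡_)

record Graph : Set where
  constructor mkGraph
  field
    vertices : List ℕ
    edges    : List (ℕ × ℕ)
open Graph public

memᵇ : ℕ → List ℕ → Bool
memᵇ m xs = any (λ x → m ≡ᵇ x) xs

adjᵇ : List (ℕ × ℕ) → ℕ → ℕ → Bool
adjᵇ A u w = any (λ { (a , b) → ((a ≡ᵇ u) ∧ (b ≡ᵇ w)) ∨ ((a ≡ᵇ w) ∧ (b ≡ᵇ u)) }) A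

step : List ℕ → List (ℕ × ℕ) → List ℕ → List ℕ
step V A S = filter (λ w → Data.Bool.T? (memᵇ w S ∨ any (λ s → adjᵇ A s w) S)) V
  where import Data.Bool

iter : ℕ → List ℕ → List (ℕ × ℕ) → List ℕ → List ℕ
iter zero    V A S = S
iter (suc k) V A S = iter k V A (step V A S)

-- Vertices of V reachable from v in the spanning subgraph (V , A)
-- (|V| closure steps suffice since every simple path has < |V| edges).
reach : List ℕ → List (ℕ × ℕ) → ℕ → List ℕ
reach V A v = iter (length V) V A (v ∷ [])

-- Number of connected components of the spanning subgraph (V , A):
-- count the vertices that are the least vertex of their component.
components : List ℕ → List (ℕ × ℕ) → ℕ
components V A =
  length (filter (λ v → Data.Bool.T? (not (any (λ w → w <ᵇ v) (reach V A v)))) V)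
  where import Data.Bool

rank : List ℕ → List (ℕ × ℕ) → ℕ
rank V A = length V ∸ components V A

-- All sub(multi)sets of a list of edges (edge lists here have no repetitions).
sublists : {X : Set} → List X → List (List X)
sublists []       = [] ∷ []
sublists (e ∷ es) = map (e ∷_) (sublists es) ++ sublists es

sumℤ : List ℤ → ℤ
sumℤ = foldr ℤ._+_ (+ 0)

tutte : Graph → ℤ → ℤ → ℤ
tutte G x y = sumℤ (map term (sublists E))
  where
  V = vertices G
  E = edges G
  term : List (ℕ × ℕ) → ℤ
  term A = ((x ℤ.- + 1) ^ (rank V E ∸ rank V A)) ℤ.* ((y ℤ.- + 1) ^ (length A ∸ rank V A))

-- G connected (G nonempty here): exactly one component.
connectedᵇ : Graph → Bool
connectedᵇ G = components (vertices G) (edges G) ≡ᵇ 1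

tutteᶜ : Graph → ℤ → ℤ
tutteᶜ G y = if connectedᵇ G then tutte G (+ 1) y else + 0

-- Complete tiered graph CT(U_1,…,U_k) given the list of tiers [U_1,…,U_k]:
-- edges uv with u ∈ U_i, v ∈ U_j, i < j, u < v.
ctEdges : List (List ℕ) → List (ℕ × ℕ)
ctEdges []       = []
ctEdges (U ∷ Us) =
  concatMap (λ u → concatMap (λ W → concatMap (λ v → if u <ᵇ v then (u , v) ∷ [] else []) W) Us) U
  ++ ctEdges Us

CT : List (List ℕ) → Graph
CT Us = mkGraph (concat Us) (ctEdges Us)

module Submission where

-- The proof is deletion–contraction at the edge e = (r, r+1) of G₁ = CT(U₁∪{r}, U₂∪{r+1}).
-- Deleting e gives G₂ = CT(U₁∪{r+1}, U₂∪{r}) after swapping the labels r and r+1 (two consecutive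
-- integers compare in the same way with every other integer), and contracting e onto r gives
-- G₀ = CT(U₁,{r},U₂) up to the order of the edges; hence T^c(G₁) = T^c(G₀) + T^c(G₂).

open import Defs
open import Data.Bool using (Bool; true; false; T; not; _∧_; _∨_; if_then_else_)
open import Data.Bool.Properties using (T-∨; T-∧; T-≡; ⇔→≡)
open import Data.Bool.ListAction using (any)
open import Data.Integer as ℤ using (ℤ; +_; _-_; _*_; _^_)
import Data.Integer.Properties as ℤP
import Algebra.Properties.CommutativeSemigroup ℤP.+-commutativeSemigroup as ℤ+
open import Data.Nat using (ℕ; zero; suc; _+_; _∸_; _≤_; _<_; _≡ᵇ_; _<ᵇ_; z≤n; s≤s)
open import Data.Nat.Properties as ℕP using (≡ᵇ⇒≡; ≡⇒≡ᵇ; _≟_)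
open import Data.List using (List; []; _∷_; _++_; map; length; filter; concat; concatMap)
open import Data.List.Membership.Propositional using (_∈_; _∉_; lose; find)
open import Data.List.Membership.Propositional.Properties
  using (∈-filter⁺; ∈-filter⁻; ∈-++⁺ˡ; ∈-++⁺ʳ; ∈-++⁻; ∈-map⁺; ∈-map⁻; ∈-concat⁺′; ∈-concat⁻′)
open import Data.List.Properties
  using ( length-filter; filter-complete; filter-some; map-++; map-∘; length-map; length-++
        ; concatMap-++; concatMap-cong; ++-identityʳ; ++-assoc; map-id-local; map-concatMap)
open import Data.List.Relation.Unary.Any as Any using (Any; here; there; any?)
open import Data.List.Relation.Unary.Any.Properties using (any⁺; any⁻; concatMap⁻)
open import Data.List.Relation.Unary.All as All using ([]; _∷_)
open import Data.List.Relation.Unary.AllPairs using ([]; _∷_)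
open import Data.List.Relation.Unary.Unique.Propositional using (Unique)
import Data.List.Relation.Unary.Unique.Propositional.Properties as Unique
open import Data.List.Relation.Binary.Permutation.Propositional as ↭ using (_↭_; prep; swap; ↭-sym)
open import Data.List.Relation.Binary.Permutation.Propositional.Properties
  using (↭-length; ∈-resp-↭; ++⁺; ++⁺ʳ; ++-comm)
open import Data.Product as Product using (Σ; _×_; _,_; proj₁; proj₂)
open import Data.Sum using (_⊎_; inj₁; inj₂)
open import Data.Empty using (⊥-elim)
open import Data.Unit using (tt)
open import Relation.Nullary using (¬_; yes; no; contradiction)
open import Relation.Nullary.Decidable using (T?; ¬?; _×-dec_)
open import Function.Base using (_∘_)
open import Function.Bundles using (_⇔_; mk⇔; Equivalence)
import Function.Properties.Equivalence as ⇔
open import Relation.Binary.PropositionalEquality using (_≡_; _≢_; refl; sym; trans; cong; cong₂; subst; subst₂)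
open Relation.Binary.PropositionalEquality.≡-Reasoning

Edge : Set
Edge = ℕ × ℕ

Adjacent : List Edge → ℕ → ℕ → Set
Adjacent A u w = (u , w) ∈ A ⊎ (w , u) ∈ A

memᵇ⇒∈ : ∀ {m} xs → T (memᵇ m xs) → m ∈ xs
memᵇ⇒∈ {m} xs t = Any.map (λ {x} → ≡ᵇ⇒≡ m x) (any⁻ _ xs t)

∈⇒memᵇ : ∀ {m xs} → m ∈ xs → T (memᵇ m xs)
∈⇒memᵇ {m} i = any⁺ _ (Any.map (λ { refl → ≡⇒≡ᵇ m m refl }) i)

adjᵇ⇒Adjacent : ∀ A {u w} → T (adjᵇ A u w) → Adjacent A u w
adjᵇ⇒Adjacent A {u} {w} t = split (Any.map (λ { {a , b} → orientation a b }) (any⁻ _ A t))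
  where
  orientation : ∀ a b → T (((a ≡ᵇ u) ∧ (b ≡ᵇ w)) ∨ ((a ≡ᵇ w) ∧ (b ≡ᵇ u))) →
                (a , b) ≡ (u , w) ⊎ (a , b) ≡ (w , u)
  orientation a b t with Equivalence.to T-∨ t
  ... | inj₁ t₁ with Equivalence.to T-∧ t₁
  ...   | p , q = inj₁ (cong₂ _,_ (≡ᵇ⇒≡ a u p) (≡ᵇ⇒≡ b w q))
  orientation a b t | inj₂ t₂ with Equivalence.to T-∧ t₂
  ...   | p , q = inj₂ (cong₂ _,_ (≡ᵇ⇒≡ a w p) (≡ᵇ⇒≡ b u q))
  split : ∀ {B} → Any (λ x → x ≡ (u , w) ⊎ x ≡ (w , u)) B → Adjacent B u w
  split (here (inj₁ refl)) = inj₁ (here refl)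
  split (here (inj₂ refl)) = inj₂ (here refl)
  split (there i) with split i
  ... | inj₁ j = inj₁ (there j)
  ... | inj₂ j = inj₂ (there j)

≡ᵇ-refl² : ∀ a b → T ((a ≡ᵇ a) ∧ (b ≡ᵇ b))
≡ᵇ-refl² a b = Equivalence.from T-∧ (≡⇒≡ᵇ a a refl , ≡⇒≡ᵇ b b refl)

Adjacent⇒adjᵇ : ∀ A {u w} → Adjacent A u w → T (adjᵇ A u w)
Adjacent⇒adjᵇ A {u} {w} (inj₁ i) =
  any⁺ _ (Any.map (λ { refl → Equivalence.from T-∨ (inj₁ (≡ᵇ-refl² u w)) }) i)
Adjacent⇒adjᵇ A {u} {w} (inj₂ i) =
  any⁺ _ (Any.map (λ { refl → Equivalence.from T-∨ (inj₂ (≡ᵇ-refl² w u)) }) i)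

T-not⁻ : ∀ {b} → T (not b) → ¬ T b
T-not⁻ {true}  () _
T-not⁻ {false} _  ()

T-not⁺ : ∀ {b} → ¬ T b → T (not b)
T-not⁺ {true}  ¬t = ¬t tt
T-not⁺ {false} _  = tt

data Walk (V : List ℕ) (A : List Edge) (u : ℕ) : ℕ → Set where
  start  : u ∈ V → Walk V A u u
  extend : ∀ {v w} → Walk V A u v → Adjacent A v w → w ∈ V → Walk V A u w

walk-end : ∀ {V A u w} → Walk V A u w → w ∈ V
walk-end (start i)      = i
walk-end (extend _ _ i) = i

walk-++ : ∀ {V A u v w} → Walk V A u v → Walk V A v w → Walk V A u w
walk-++ p (start _)      = p
walk-++ p (extend q a i) = extend (walk-++ p q) a i

flip-adjacent : ∀ {A u w} → Adjacent A u w → Adjacent A w u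
flip-adjacent (inj₁ i) = inj₂ i
flip-adjacent (inj₂ i) = inj₁ i

walk-reverse : ∀ {V A u w} → Walk V A u w → Walk V A w u
walk-reverse (start i) = start i
walk-reverse (extend p a i) = walk-++ (extend (start i) (flip-adjacent a) (walk-end p)) (walk-reverse p)

walk-reroute : ∀ {V A A′ u w} → (∀ {a b} → Adjacent A a b → Adjacent A′ a b ⊎ a ≡ b) →
               Walk V A u w → Walk V A′ u w
walk-reroute h (start i) = start i
walk-reroute h (extend p a i) with h a
... | inj₁ a′   = extend (walk-reroute h p) a′ i
... | inj₂ refl = walk-reroute h p

Connected : List ℕ → List Edge → Set
Connected V A = ∀ u w → u ∈ V → w ∈ V → Walk V A u w

connected-reroute : ∀ {V} A A′ → (∀ {x} → x ∈ A → x ∈ A′ ⊎ proj₁ x ≡ proj₂ x) →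
                    Connected V A → Connected V A′
connected-reroute A A′ h c u w u∈V w∈V = walk-reroute reroute (c u w u∈V w∈V)
  where
  reroute : ∀ {a b} → Adjacent A a b → Adjacent A′ a b ⊎ a ≡ b
  reroute (inj₁ i) with h i
  ... | inj₁ j = inj₁ (inj₁ j)
  ... | inj₂ e = inj₂ e
  reroute (inj₂ i) with h i
  ... | inj₁ j = inj₁ (inj₂ j)
  ... | inj₂ e = inj₂ (sym e)

length-pos : ∀ {X : Set} {x : X} {xs} → x ∈ xs → 1 ≤ length xs
length-pos {xs = _ ∷ _} _ = s≤s z≤n

module _ {X : Set} (p q : X → Bool) where

  filter-mono : ∀ xs → (∀ {x} → x ∈ xs → T (p x) → T (q x)) →
                length (filter (T? ∘ p) xs) ≤ length (filter (T? ∘ q) xs)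
  filter-mono []       _ = z≤n
  filter-mono (y ∷ xs) p⇒q with p y in ep | q y in eq
  ... | true  | true  = s≤s (filter-mono xs (p⇒q ∘ there))
  ... | true  | false = ⊥-elim (subst T eq (p⇒q (here refl) (subst T (sym ep) tt)))
  ... | false | true  = ℕP.m≤n⇒m≤1+n (filter-mono xs (p⇒q ∘ there))
  ... | false | false = filter-mono xs (p⇒q ∘ there)

  filter-strict-mono : ∀ xs → (∀ {x} → x ∈ xs → T (p x) → T (q x)) →
                       Any (λ z → T (q z) × ¬ T (p z)) xs →
                       length (filter (T? ∘ p) xs) < length (filter (T? ∘ q) xs)
  filter-strict-mono (y ∷ xs) p⇒q (here (qy , ¬py)) with p y | q y
  ... | true  | _     = ⊥-elim (¬py tt)
  ... | false | false = ⊥-elim qy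
  ... | false | true  = s≤s (filter-mono xs (p⇒q ∘ there))
  filter-strict-mono (y ∷ xs) p⇒q (there new) with p y in ep | q y in eq
  ... | true  | true  = s≤s (filter-strict-mono xs (p⇒q ∘ there) new)
  ... | true  | false = ⊥-elim (subst T eq (p⇒q (here refl) (subst T (sym ep) tt)))
  ... | false | true  = ℕP.m≤n⇒m≤1+n (filter-strict-mono xs (p⇒q ∘ there) new)
  ... | false | false = filter-strict-mono xs (p⇒q ∘ there) new

Touches : List Edge → List ℕ → ℕ → Set
Touches A S w = w ∈ S ⊎ Σ ℕ λ s → s ∈ S × Adjacent A s w

touchesᵇ : List Edge → List ℕ → ℕ → Bool
touchesᵇ A S w = memᵇ w S ∨ any (λ s → adjᵇ A s w) S

touchesᵇ⇒Touches : ∀ A S {w} → T (touchesᵇ A S w) → Touches A S w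
touchesᵇ⇒Touches A S {w} t with Equivalence.to T-∨ t
... | inj₁ m = inj₁ (memᵇ⇒∈ S m)
... | inj₂ a = inj₂ (find (Any.map (adjᵇ⇒Adjacent A) (any⁻ _ S a)))

Touches⇒touchesᵇ : ∀ A S {w} → Touches A S w → T (touchesᵇ A S w)
Touches⇒touchesᵇ A S (inj₁ i) = Equivalence.from T-∨ (inj₁ (∈⇒memᵇ i))
Touches⇒touchesᵇ A S (inj₂ (s , i , a)) =
  Equivalence.from T-∨ (inj₂ (any⁺ _ (lose i (Adjacent⇒adjᵇ A a))))

step-∈⁻ : ∀ V A S {w} → w ∈ step V A S → w ∈ V × Touches A S w
step-∈⁻ V A S i with ∈-filter⁻ (T? ∘ touchesᵇ A S) {xs = V} i
... | w∈V , t = w∈V , touchesᵇ⇒Touches A S t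

step-∈⁺ : ∀ V A S {w} → w ∈ V → Touches A S w → w ∈ step V A S
step-∈⁺ V A S w∈V t = ∈-filter⁺ (T? ∘ touchesᵇ A S) w∈V (Touches⇒touchesᵇ A S t)

Closed : List ℕ → List Edge → List ℕ → Set
Closed V A S = ∀ {s w} → s ∈ S → Adjacent A s w → w ∈ V → w ∈ S

closed-walk : ∀ {V A S v w} → Closed V A S → v ∈ S → Walk V A v w → w ∈ S
closed-walk c v∈S (start _)        = v∈S
closed-walk c v∈S (extend p a w∈V) = c (closed-walk c v∈S p) a w∈V

step-closed : ∀ V A S → Closed V A S → Closed V A (step V A S)
step-closed V A S c s∈T a w∈V with step-∈⁻ V A S s∈T
... | _   , inj₁ s∈S            = step-∈⁺ V A S w∈V (inj₁ (c s∈S a w∈V))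
... | s∈V , inj₂ (t , t∈S , a′) = step-∈⁺ V A S w∈V (inj₁ (c (c t∈S a′ s∈V) a w∈V))

-- Either step S is already closed, or stepping once more strictly enlarges it:
-- a vertex touching step S but not S is counted by the second filter only.
grow-or-close : ∀ V A S →
  Closed V A (step V A S) ⊎ length (step V A S) < length (step V A (step V A S))
grow-or-close V A S with any? (λ x → T? (touchesᵇ A (step V A S) x) ×-dec ¬? (T? (touchesᵇ A S x))) V
... | yes new  = inj₂ (filter-strict-mono (touchesᵇ A S) (touchesᵇ A (step V A S)) V older new)
  where
  older : ∀ {x} → x ∈ V → T (touchesᵇ A S x) → T (touchesᵇ A (step V A S) x)
  older x∈V t = Equivalence.from T-∨ (inj₁ (∈⇒memᵇ (∈-filter⁺ (T? ∘ touchesᵇ A S) x∈V t)))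
... | no none = inj₁ closed
  where
  closed : Closed V A (step V A S)
  closed {s} {w} s∈T a w∈V with T? (touchesᵇ A S w)
  ... | yes t  = ∈-filter⁺ (T? ∘ touchesᵇ A S) w∈V t
  ... | no ¬t = contradiction (lose w∈V (Touches⇒touchesᵇ A (step V A S) (inj₂ (s , s∈T , a)) , ¬t)) none

-- `iter` applies `step` innermost first; `grow` is the same iteration written outermost first.
grow : List ℕ → List Edge → ℕ → List ℕ → List ℕ
grow V A zero    S = S
grow V A (suc k) S = step V A (grow V A k S)

iter≡grow : ∀ V A k S → iter k V A S ≡ grow V A k S
iter≡grow V A zero    S = refl
iter≡grow V A (suc k) S = trans (iter≡grow V A k (step V A S)) (grow-step k S)
  where
  grow-step : ∀ k S → grow V A k (step V A S) ≡ step V A (grow V A k S)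
  grow-step zero    S = refl
  grow-step (suc k) S = cong (step V A) (grow-step k S)

grow-keeps : ∀ V A k S {w} → w ∈ S → w ∈ V → w ∈ grow V A k S
grow-keeps V A zero    S w∈S w∈V = w∈S
grow-keeps V A (suc k) S w∈S w∈V = step-∈⁺ V A _ w∈V (inj₁ (grow-keeps V A k S w∈S w∈V))

grow-reachable : ∀ V A k S {v} → (∀ {s} → s ∈ S → Walk V A v s) →
                 ∀ {w} → w ∈ grow V A k S → Walk V A v w
grow-reachable V A zero    S h w∈ = h w∈
grow-reachable V A (suc k) S h w∈ with step-∈⁻ V A _ w∈
... | _   , inj₁ w∈′            = grow-reachable V A k S h w∈′
... | w∈V , inj₂ (s , s∈ , a) = extend (grow-reachable V A k S h s∈) a w∈V

module Closure (V : List ℕ) (A : List Edge) {v : ℕ} (v∈V : v ∈ V) where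

  ball : ℕ → List ℕ
  ball k = grow V A k (v ∷ [])

  closed-or-large : ∀ k → Closed V A (ball (suc k)) ⊎ suc k ≤ length (ball (suc k))
  closed-or-large zero = inj₂ (length-pos (grow-keeps V A 1 (v ∷ []) (here refl) v∈V))
  closed-or-large (suc k) with closed-or-large k | grow-or-close V A (ball k)
  ... | inj₁ closed | _            = inj₁ (step-closed V A _ closed)
  ... | inj₂ _      | inj₁ closed  = inj₁ (step-closed V A _ closed)
  ... | inj₂ large  | inj₂ larger = inj₂ (ℕP.≤-trans (s≤s large) larger)

  -- After |V| steps the set is closed: otherwise it would be all of V.
  reach-closed : Closed V A (reach V A v)
  reach-closed rewrite iter≡grow V A (length V) (v ∷ []) = final (length V) refl
    where
    final : ∀ n → n ≡ length V → Closed V A (ball n)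
    final zero    n≡ = contradiction n≡ (ℕP.<⇒≢ (length-pos v∈V))
    final (suc m) n≡ with closed-or-large m
    ... | inj₁ closed = closed
    ... | inj₂ large  = λ _ _ w∈V → subst (_ ∈_) (sym everything) w∈V
      where
      everything : ball (suc m) ≡ V
      everything = filter-complete (T? ∘ touchesᵇ A (ball m))
        (ℕP.≤-antisym (length-filter (T? ∘ touchesᵇ A (ball m)) V) (subst (_≤ length (ball (suc m))) n≡ large))

reach-complete : ∀ V A {v w} → v ∈ V → Walk V A v w → w ∈ reach V A v
reach-complete V A v∈V p =
  closed-walk (Closure.reach-closed V A v∈V)
    (subst (_ ∈_) (sym (iter≡grow V A (length V) _)) (grow-keeps V A (length V) _ (here refl) v∈V)) p

reach-sound : ∀ V A {v w} → v ∈ V → w ∈ reach V A v → Walk V A v w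
reach-sound V A v∈V w∈ =
  grow-reachable V A (length V) _ (λ { (here refl) → start v∈V }) (subst (_ ∈_) (iter≡grow V A (length V) _) w∈)

leaderᵇ : List ℕ → List Edge → ℕ → Bool
leaderᵇ V A v = not (any (λ w → w <ᵇ v) (reach V A v))

IsLeast : List ℕ → List Edge → ℕ → Set
IsLeast V A v = ∀ {w} → Walk V A v w → v ≤ w

leader⇒least : ∀ V A {v} → v ∈ V → T (leaderᵇ V A v) → IsLeast V A v
leader⇒least V A {v} v∈V t p = ℕP.≮⇒≥ λ w<v →
  T-not⁻ t (any⁺ _ (lose (reach-complete V A v∈V p) (ℕP.<⇒<ᵇ w<v)))

least⇒leader : ∀ V A {v} → v ∈ V → IsLeast V A v → T (leaderᵇ V A v)
least⇒leader V A {v} v∈V least = T-not⁺ λ t →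
  let (w , w∈ , w<v) = find (any⁻ _ _ t)
  in ℕP.<⇒≱ (ℕP.<ᵇ⇒< w v w<v) (least (reach-sound V A v∈V w∈))

least-element : ∀ {v} (L : List ℕ) → v ∈ L → Σ ℕ λ m → m ∈ L × (∀ {w} → w ∈ L → m ≤ w)
least-element (x ∷ []) _ = x , here refl , λ { (here refl) → ℕP.≤-refl }
least-element (x ∷ y ∷ xs) _ with least-element (y ∷ xs) (here refl)
... | m , m∈ , least with m ℕP.≤? x
...   | yes m≤x = m , there m∈ , λ { (here refl) → m≤x ; (there i) → least i }
...   | no  m≰x = x , here refl , λ { (here refl) → ℕP.≤-refl
                                    ; (there i) → ℕP.≤-trans (ℕP.<⇒≤ (ℕP.≰⇒> m≰x)) (least i) }

-- Every vertex reaches a leader: the least vertex it can reach.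
leader-of : ∀ V A {v} → v ∈ V → Σ ℕ λ m → Walk V A v m × T (leaderᵇ V A m)
leader-of V A {v} v∈V with least-element (reach V A v) (reach-complete V A v∈V (start v∈V))
... | m , m∈ , least = m , v⇝m , least⇒leader V A (walk-end v⇝m)
        (λ m⇝w → least (reach-complete V A v∈V (walk-++ v⇝m m⇝w)))
  where v⇝m = reach-sound V A v∈V m∈

unique-constant : ∀ {X : Set} {m : X} {L} → Unique L → m ∈ L → (∀ {x} → x ∈ L → x ≡ m) → length L ≡ 1
unique-constant {L = _ ∷ []}    _                _ _    = refl
unique-constant {L = _ ∷ _ ∷ _} ((x≢y ∷ _) ∷ _) _ same =
  contradiction (trans (same (here refl)) (sym (same (there (here refl))))) x≢y

singleton-eq : ∀ {X : Set} {L : List X} {a b} → length L ≡ 1 → a ∈ L → b ∈ L → a ≡ b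
singleton-eq {L = _ ∷ []} _ (here refl) (here refl) = refl

connected⇒one : ∀ V A {v} → v ∈ V → Unique V → Connected V A → components V A ≡ 1
connected⇒one V A v∈V uniq conn with least-element V v∈V
... | m , m∈V , least = unique-constant (Unique.filter⁺ (T? ∘ leaderᵇ V A) uniq)
        (∈-filter⁺ (T? ∘ leaderᵇ V A) m∈V (least⇒leader V A m∈V (least ∘ walk-end)))
        only-m
  where
  only-m : ∀ {x} → x ∈ filter (T? ∘ leaderᵇ V A) V → x ≡ m
  only-m x∈ with ∈-filter⁻ (T? ∘ leaderᵇ V A) {xs = V} x∈
  ... | x∈V , lead = ℕP.≤-antisym (leader⇒least V A x∈V lead (conn _ _ x∈V m∈V)) (least x∈V)

-- With a single leader, any two vertices reach the same leader, hence each other.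
one⇒connected : ∀ V A → components V A ≡ 1 → Connected V A
one⇒connected V A one u w u∈V w∈V with leader-of V A u∈V | leader-of V A w∈V
... | _ , u⇝m , lead | _ , w⇝m′ , lead′
  with singleton-eq one (∈-filter⁺ (T? ∘ leaderᵇ V A) (walk-end u⇝m) lead)
                        (∈-filter⁺ (T? ∘ leaderᵇ V A) (walk-end w⇝m′) lead′)
...   | refl = walk-++ u⇝m (walk-reverse w⇝m′)

connectedᵇ⇔Connected : ∀ V A {v} → v ∈ V → Unique V → T (connectedᵇ (mkGraph V A)) ⇔ Connected V A
connectedᵇ⇔Connected V A v∈V uniq =
  mk⇔ (λ t → one⇒connected V A (≡ᵇ⇒≡ _ 1 t)) (λ c → ≡⇒≡ᵇ _ 1 (connected⇒one V A v∈V uniq c))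

connectedᵇ-cong : ∀ V A V′ A′ {v v′} → v ∈ V → Unique V → v′ ∈ V′ → Unique V′ →
                  Connected V A ⇔ Connected V′ A′ →
                  connectedᵇ (mkGraph V A) ≡ connectedᵇ (mkGraph V′ A′)
connectedᵇ-cong V A V′ A′ v∈V uniq v′∈V′ uniq′ same = ⇔→≡ {z = true}
  (⇔.trans (⇔.sym T-≡) (⇔.trans (connectedᵇ⇔Connected V A v∈V uniq)
    (⇔.trans same (⇔.trans (⇔.sym (connectedᵇ⇔Connected V′ A′ v′∈V′ uniq′)) T-≡))))

Σ⊆ : ∀ {X : Set} → List X → (List X → ℤ) → ℤ
Σ⊆ E f = sumℤ (map f (sublists E))

sum-cong : ∀ {X : Set} {f g : X → ℤ} L → (∀ {x} → x ∈ L → f x ≡ g x) → sumℤ (map f L) ≡ sumℤ (map g L)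
sum-cong []      _  = refl
sum-cong (x ∷ L) eq = cong₂ ℤ._+_ (eq (here refl)) (sum-cong L (eq ∘ there))

sum-zero : ∀ {X : Set} {f : X → ℤ} L → (∀ {x} → x ∈ L → f x ≡ + 0) → sumℤ (map f L) ≡ + 0
sum-zero []      _      = refl
sum-zero (x ∷ L) vanish = cong₂ ℤ._+_ (vanish (here refl)) (sum-zero L (vanish ∘ there))

sum-++ : ∀ (xs ys : List ℤ) → sumℤ (xs ++ ys) ≡ sumℤ xs ℤ.+ sumℤ ys
sum-++ []       ys = sym (ℤP.+-identityˡ _)
sum-++ (x ∷ xs) ys = trans (cong (λ s → x ℤ.+ s) (sum-++ xs ys)) (sym (ℤP.+-assoc x (sumℤ xs) (sumℤ ys)))

module _ {X : Set} where

  sublists-⊆ : ∀ {A : List X} E → A ∈ sublists E → ∀ {x} → x ∈ A → x ∈ E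
  sublists-⊆ [] (here refl) ()
  sublists-⊆ (e ∷ E) A∈ x∈A with ∈-++⁻ (map (e ∷_) (sublists E)) A∈
  ... | inj₂ A∈′ = there (sublists-⊆ E A∈′ x∈A)
  ... | inj₁ eA∈ with ∈-map⁻ (e ∷_) eA∈
  ...   | B , B∈ , refl with x∈A
  ...     | here refl = here refl
  ...     | there x∈B = there (sublists-⊆ E B∈ x∈B)

  Σ⊆-∷ : ∀ (f : List X → ℤ) x E → Σ⊆ (x ∷ E) f ≡ Σ⊆ E (f ∘ (x ∷_)) ℤ.+ Σ⊆ E f
  Σ⊆-∷ f x E = begin
    sumℤ (map f (map (x ∷_) (sublists E) ++ sublists E))
      ≡⟨ cong sumℤ (map-++ f (map (x ∷_) (sublists E)) (sublists E)) ⟩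
    sumℤ (map f (map (x ∷_) (sublists E)) ++ map f (sublists E))
      ≡⟨ sum-++ (map f (map (x ∷_) (sublists E))) _ ⟩
    sumℤ (map f (map (x ∷_) (sublists E))) ℤ.+ Σ⊆ E f
      ≡⟨ cong (λ L → sumℤ L ℤ.+ Σ⊆ E f) (sym (map-∘ (sublists E))) ⟩
    Σ⊆ E (f ∘ (x ∷_)) ℤ.+ Σ⊆ E f ∎

  Σ⊆-↭ : ∀ (f : List X → ℤ) {E E′} → E ↭ E′ → (∀ {A B} → A ↭ B → f A ≡ f B) →
         Σ⊆ E f ≡ Σ⊆ E′ f
  Σ⊆-↭ f ↭.refl        _   = refl
  Σ⊆-↭ f (↭.trans p q) inv = trans (Σ⊆-↭ f p inv) (Σ⊆-↭ f q inv)
  Σ⊆-↭ f {x ∷ E} {x ∷ E′} (prep x p) inv = begin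
    Σ⊆ (x ∷ E) f
      ≡⟨ Σ⊆-∷ f x E ⟩
    Σ⊆ E (f ∘ (x ∷_)) ℤ.+ Σ⊆ E f
      ≡⟨ cong₂ ℤ._+_ (Σ⊆-↭ (f ∘ (x ∷_)) p (inv ∘ prep x)) (Σ⊆-↭ f p inv) ⟩
    Σ⊆ E′ (f ∘ (x ∷_)) ℤ.+ Σ⊆ E′ f
      ≡⟨ Σ⊆-∷ f x E′ ⟨
    Σ⊆ (x ∷ E′) f ∎
  Σ⊆-↭ f {x ∷ y ∷ E} {y ∷ x ∷ E′} (swap x y p) inv = begin
    Σ⊆ (x ∷ y ∷ E) f
      ≡⟨ trans (Σ⊆-∷ f x (y ∷ E)) (cong₂ ℤ._+_ (Σ⊆-∷ _ y E) (Σ⊆-∷ f y E)) ⟩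
    (Σ⊆ E (f ∘ (x ∷_) ∘ (y ∷_)) ℤ.+ Σ⊆ E (f ∘ (x ∷_))) ℤ.+ (Σ⊆ E (f ∘ (y ∷_)) ℤ.+ Σ⊆ E f)
      ≡⟨ ℤ+.interchange (Σ⊆ E (f ∘ (x ∷_) ∘ (y ∷_))) (Σ⊆ E (f ∘ (x ∷_)))
                        (Σ⊆ E (f ∘ (y ∷_))) (Σ⊆ E f) ⟩
    (Σ⊆ E (f ∘ (x ∷_) ∘ (y ∷_)) ℤ.+ Σ⊆ E (f ∘ (y ∷_))) ℤ.+ (Σ⊆ E (f ∘ (x ∷_)) ℤ.+ Σ⊆ E f)
      ≡⟨ cong₂ ℤ._+_ (cong₂ ℤ._+_ (trans (Σ⊆-↭ _ p (inv ∘ prep x ∘ prep y))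
                                         (sum-cong (sublists E′) (λ _ → inv (swap x y ↭.refl))))
                                  (Σ⊆-↭ _ p (inv ∘ prep y)))
                     (cong₂ ℤ._+_ (Σ⊆-↭ _ p (inv ∘ prep x)) (Σ⊆-↭ f p inv)) ⟩
    (Σ⊆ E′ (f ∘ (y ∷_) ∘ (x ∷_)) ℤ.+ Σ⊆ E′ (f ∘ (y ∷_))) ℤ.+ (Σ⊆ E′ (f ∘ (x ∷_)) ℤ.+ Σ⊆ E′ f)
      ≡⟨ trans (Σ⊆-∷ f y (x ∷ E′)) (cong₂ ℤ._+_ (Σ⊆-∷ _ x E′) (Σ⊆-∷ f x E′)) ⟨
    Σ⊆ (y ∷ x ∷ E′) f ∎

sublists-map : ∀ {X Y : Set} (φ : X → Y) xs → sublists (map φ xs) ≡ map (map φ) (sublists xs)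
sublists-map φ []       = refl
sublists-map φ (x ∷ xs) = begin
  map (φ x ∷_) (sublists (map φ xs)) ++ sublists (map φ xs)
    ≡⟨ cong (λ S → map (φ x ∷_) S ++ S) (sublists-map φ xs) ⟩
  map (φ x ∷_) (map (map φ) (sublists xs)) ++ map (map φ) (sublists xs)
    ≡⟨ cong (_++ map (map φ) (sublists xs)) (trans (sym (map-∘ (sublists xs))) (map-∘ (sublists xs))) ⟩
  map (map φ) (map (x ∷_) (sublists xs)) ++ map (map φ) (sublists xs)
    ≡⟨ map-++ (map φ) (map (x ∷_) (sublists xs)) (sublists xs) ⟨
  map (map φ) (map (x ∷_) (sublists xs) ++ sublists xs) ∎

Σ⊆-map : ∀ {X Y : Set} (f : List Y → ℤ) (φ : X → Y) E → Σ⊆ (map φ E) f ≡ Σ⊆ E (f ∘ map φ)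
Σ⊆-map f φ E = trans (cong (sumℤ ∘ map f) (sublists-map φ E)) (cong sumℤ (sym (map-∘ (sublists E))))

components-pos : ∀ V A {v} → v ∈ V → 1 ≤ components V A
components-pos V A v∈V with leader-of V A v∈V
... | _ , v⇝m , lead = filter-some (T? ∘ leaderᵇ V A) (lose (walk-end v⇝m) lead)

components≤ : ∀ V A → components V A ≤ length V
components≤ V A = length-filter (T? ∘ leaderᵇ V A) V

weight : List ℕ → ℤ → List Edge → ℤ
weight V y A = if connectedᵇ (mkGraph V A) then (y - + 1) ^ (length A ∸ (length V ∸ 1)) else + 0

zero-power : ∀ L c → 2 ≤ c → c ≤ L → (+ 1 - + 1) ^ ((L ∸ 1) ∸ (L ∸ c)) ≡ + 0
zero-power (suc L) (suc (suc k)) (s≤s (s≤s z≤n)) c≤L rewrite ℕP.m∸[m∸n]≡n (ℕP.≤-pred c≤L) = refl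

-- In a connected graph the factor (1-1)^{r(E)-r(A)} of T(1,y) kills every
-- disconnected spanning subgraph, and equals 1 on the connected ones.
term≡weight : ∀ V E y A {v} → v ∈ V → components V E ≡ 1 →
  ((+ 1 - + 1) ^ (rank V E ∸ rank V A)) * ((y - + 1) ^ (length A ∸ rank V A)) ≡ weight V y A
term≡weight V E y A v∈V oneE with connectedᵇ (mkGraph V A) in cA
... | true rewrite oneE | ≡ᵇ⇒≡ (components V A) 1 (subst T (sym cA) tt) | ℕP.n∸n≡0 (length V ∸ 1) =
  ℤP.*-identityˡ _
... | false rewrite oneE | zero-power (length V) (components V A)
                        (ℕP.≤∧≢⇒< (components-pos V A v∈V)
                                  (λ one → subst T cA (≡⇒≡ᵇ (components V A) 1 (sym one))))
                        (components≤ V A) = ℤP.*-zeroˡ ((y - + 1) ^ (length A ∸ (length V ∸ components V A)))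

tutteᶜ-expansion : ∀ V E y {v} → v ∈ V → Unique V →
                   tutteᶜ (mkGraph V E) y ≡ Σ⊆ E (weight V y)
tutteᶜ-expansion V E y v∈V uniq with connectedᵇ (mkGraph V E) in cE
... | true  = sum-cong (sublists E) (λ {A} _ → term≡weight V E y A v∈V (≡ᵇ⇒≡ _ 1 (subst T (sym cE) tt)))
... | false = sym (sum-zero (sublists E) disconnected)
  where
  disconnected : ∀ {A} → A ∈ sublists E → weight V y A ≡ + 0
  disconnected {A} A∈ with connectedᵇ (mkGraph V A) in cA
  ... | false = refl
  ... | true  = ⊥-elim (subst T cE (Equivalence.from (connectedᵇ⇔Connected V E v∈V uniq)
                  (connected-reroute A E (inj₁ ∘ sublists-⊆ E A∈)
                    (Equivalence.to (connectedᵇ⇔Connected V A v∈V uniq) (subst T (sym cA) tt)))))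

weight-cong : ∀ V A V′ A′ y → connectedᵇ (mkGraph V A) ≡ connectedᵇ (mkGraph V′ A′) →
              length A ∸ (length V ∸ 1) ≡ length A′ ∸ (length V′ ∸ 1) → weight V y A ≡ weight V′ y A′
weight-cong V A V′ A′ y = cong₂ (λ c n → if c then (y - + 1) ^ n else + 0)

weight-↭ : ∀ V y {v} → v ∈ V → Unique V → ∀ {A B} → A ↭ B → weight V y A ≡ weight V y B
weight-↭ V y v∈V uniq {A} {B} A↭B = weight-cong V A V B y
  (connectedᵇ-cong V A V B v∈V uniq v∈V uniq
    (mk⇔ (connected-reroute A B (inj₁ ∘ ∈-resp-↭ A↭B))
         (connected-reroute B A (inj₁ ∘ ∈-resp-↭ (↭-sym A↭B)))))
  (cong (_∸ (length V ∸ 1)) (↭-length A↭B))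

mapEdge : (ℕ → ℕ) → Edge → Edge
mapEdge φ (a , b) = φ a , φ b

module VertexMap (φ : ℕ → ℕ) (V W : List ℕ) (A : List Edge)
  (into     : ∀ {v} → v ∈ V → φ v ∈ W)
  (onto     : ∀ {w} → w ∈ W → Σ ℕ λ v → v ∈ V × φ v ≡ w)
  (edges-in : ∀ {a b} → (a , b) ∈ A → a ∈ V × b ∈ V)
  (fibres   : ∀ {v v′} → v ∈ V → v′ ∈ V → φ v ≡ φ v′ → Walk V A v v′) where

  φA : List Edge
  φA = map (mapEdge φ) A

  push : ∀ {u w} → Walk V A u w → Walk W φA (φ u) (φ w)
  push (start u∈V) = start (into u∈V)
  push (extend p (inj₁ i) w∈V) = extend (push p) (inj₁ (∈-map⁺ (mapEdge φ) i)) (into w∈V)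
  push (extend p (inj₂ i) w∈V) = extend (push p) (inj₂ (∈-map⁺ (mapEdge φ) i)) (into w∈V)

  -- Lift each image edge to an edge of A and bridge the gaps inside fibres.
  pull : ∀ {x z} → Walk W φA x z →
         ∀ {v v′} → v ∈ V → v′ ∈ V → φ v ≡ x → φ v′ ≡ z → Walk V A v v′
  pull (start _) v∈V v′∈V refl eq = fibres v∈V v′∈V (sym eq)
  pull (extend p adj _) v∈V v′∈V eq eq′ with adj
  ... | inj₁ i with ∈-map⁻ (mapEdge φ) i
  ...   | (a , b) , ab∈A , refl = let (a∈V , b∈V) = edges-in ab∈A in
          walk-++ (extend (pull p v∈V a∈V eq refl) (inj₁ ab∈A) b∈V) (fibres b∈V v′∈V (sym eq′))
  pull (extend p adj _) v∈V v′∈V eq eq′ | inj₂ i with ∈-map⁻ (mapEdge φ) i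
  ...   | (a , b) , ab∈A , refl = let (a∈V , b∈V) = edges-in ab∈A in
          walk-++ (extend (pull p v∈V b∈V eq refl) (inj₂ ab∈A) a∈V) (fibres a∈V v′∈V (sym eq′))

  connected⇔ : Connected V A ⇔ Connected W φA
  connected⇔ = mk⇔ forward backward
    where
    forward : Connected V A → Connected W φA
    forward c x z x∈W z∈W with onto x∈W | onto z∈W
    ... | u , u∈V , refl | w , w∈V , refl = push (c u w u∈V w∈V)

    backward : Connected W φA → Connected V A
    backward c u w u∈V w∈V = pull (c (φ u) (φ w) (into u∈V) (into w∈V)) u∈V w∈V refl refl

weight-relabel : ∀ (ψ : ℕ → ℕ) V B y {v} → (∀ {x x′} → ψ x ≡ ψ x′ → x ≡ x′) →
  v ∈ V → Unique V → (∀ {a b} → (a , b) ∈ B → a ∈ V × b ∈ V) →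
  weight (map ψ V) y (map (mapEdge ψ) B) ≡ weight V y B
weight-relabel ψ V B y injective v∈V uniq edges-in = weight-cong (map ψ V) (map (mapEdge ψ) B) V B y
  (connectedᵇ-cong (map ψ V) (map (mapEdge ψ) B) V B (∈-map⁺ ψ v∈V) (Unique.map⁺ injective uniq) v∈V uniq
    (⇔.sym (VertexMap.connected⇔ ψ V (map ψ V) B (∈-map⁺ ψ) onto edges-in
      (λ v∈V _ eq → subst (Walk V B _) (injective eq) (start v∈V)))))
  (cong₂ (λ m n → m ∸ (n ∸ 1)) (length-map (mapEdge ψ) B) (length-map ψ V))
  where
  onto : ∀ {w} → w ∈ map ψ V → Σ ℕ λ x → x ∈ V × ψ x ≡ w
  onto w∈ with ∈-map⁻ ψ w∈
  ... | x , x∈V , refl = x , x∈V , refl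

unique-snoc : ∀ {W : List ℕ} {b} → Unique W → b ∉ W → Unique (W ++ b ∷ [])
unique-snoc uniqW b∉W = Unique.++⁺ uniqW ([] ∷ []) λ { (b∈W , here refl) → b∉W b∈W }

-- Adding one edge and one vertex leaves |A| - |V| + 1 unchanged.
pred-exponent : ∀ n {m} → 1 ≤ m → suc n ∸ m ≡ n ∸ (m ∸ 1)
pred-exponent n (s≤s _) = refl

-- Contracting the edge e = ab onto a, where b is a new last vertex: if φ fixes W and sends b to a,
-- then e ∷ B connects W ++ [b] iff φ(B) connects W, and the exponents |A| - |V| + 1 agree.
module Contraction (φ : ℕ → ℕ) (W : List ℕ) (B : List Edge) {a b : ℕ} (a∈W : a ∈ W) (b∉W : b ∉ W)
  (fixes : ∀ {w} → w ∈ W → φ w ≡ w) (φb≡a : φ b ≡ a)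
  (edges-in : ∀ {c d} → (c , d) ∈ B → c ∈ W ++ b ∷ [] × d ∈ W ++ b ∷ []) where

  V : List ℕ
  V = W ++ b ∷ []

  a∈V : a ∈ V
  a∈V = ∈-++⁺ˡ a∈W

  b∈V : b ∈ V
  b∈V = ∈-++⁺ʳ W (here refl)

  into : ∀ {v} → v ∈ V → φ v ∈ W
  into v∈V with ∈-++⁻ W v∈V
  ... | inj₁ v∈W         = subst (_∈ W) (sym (fixes v∈W)) v∈W
  ... | inj₂ (here refl) = subst (_∈ W) (sym φb≡a) a∈W

  onto : ∀ {w} → w ∈ W → Σ ℕ λ v → v ∈ V × φ v ≡ w
  onto w∈W = _ , ∈-++⁺ˡ w∈W , fixes w∈W

  eB φB : List Edge
  eB = (a , b) ∷ B
  φB = map (mapEdge φ) B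

  edges-in′ : ∀ {c d} → (c , d) ∈ eB → c ∈ V × d ∈ V
  edges-in′ (here refl) = a∈V , b∈V
  edges-in′ (there i)   = edges-in i

  -- Two vertices with the same image are equal or are the two ends of e.
  fibre-walk : ∀ {v v′} → v ∈ V → v′ ∈ V → φ v ≡ φ v′ → Walk V eB v v′
  fibre-walk v∈V v′∈V eq with ∈-++⁻ W v∈V | ∈-++⁻ W v′∈V
  ... | inj₁ v∈W | inj₁ v′∈W =
    subst (Walk V eB _) (trans (sym (fixes v∈W)) (trans eq (fixes v′∈W))) (start v∈V)
  ... | inj₁ v∈W | inj₂ (here refl) =
    subst (λ x → Walk V eB x b) (sym (trans (sym (fixes v∈W)) (trans eq φb≡a)))
          (extend (start a∈V) (inj₁ (here refl)) b∈V)
  ... | inj₂ (here refl) | inj₁ v′∈W =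
    subst (Walk V eB b) (trans (sym φb≡a) (trans eq (fixes v′∈W)))
          (extend (start b∈V) (inj₂ (here refl)) a∈V)
  ... | inj₂ (here refl) | inj₂ (here refl) = start v∈V

  -- The image of e is a loop, which does not matter for connectivity.
  drop-loop : ∀ {x} → x ∈ mapEdge φ (a , b) ∷ φB → x ∈ φB ⊎ proj₁ x ≡ proj₂ x
  drop-loop (here refl) = inj₂ (trans (fixes a∈W) (sym φb≡a))
  drop-loop (there i)   = inj₁ i

  connected⇔ : Connected V eB ⇔ Connected W φB
  connected⇔ = ⇔.trans (VertexMap.connected⇔ φ V W eB into onto edges-in′ fibre-walk)
    (mk⇔ (connected-reroute (mapEdge φ (a , b) ∷ φB) φB drop-loop)
         (connected-reroute φB (mapEdge φ (a , b) ∷ φB) (inj₁ ∘ there)))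

  weight-contract : ∀ y → Unique W → weight W y φB ≡ weight V y eB
  weight-contract y uniqW = weight-cong W φB V eB y
    (connectedᵇ-cong W φB V eB a∈W uniqW a∈V (unique-snoc uniqW b∉W) (⇔.sym connected⇔))
    (begin
      length φB ∸ (length W ∸ 1)      ≡⟨ cong (_∸ (length W ∸ 1)) (length-map (mapEdge φ) B) ⟩
      length B ∸ (length W ∸ 1)       ≡⟨ pred-exponent (length B) (length-pos a∈W) ⟨
      suc (length B) ∸ length W       ≡⟨ cong (λ n → suc (length B) ∸ (n ∸ 1)) |V|≡1+|W| ⟨
      suc (length B) ∸ (length V ∸ 1) ∎)
    where
    |V|≡1+|W| : length V ≡ suc (length W)
    |V|≡1+|W| = trans (length-++ W) (ℕP.+-comm (length W) 1)

concatMap-cong-∈ : ∀ {X Y : Set} {f g : X → List Y} xs → (∀ {x} → x ∈ xs → f x ≡ g x) →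
                   concatMap f xs ≡ concatMap g xs
concatMap-cong-∈ []       _  = refl
concatMap-cong-∈ (x ∷ xs) eq = cong₂ _++_ (eq (here refl)) (concatMap-cong-∈ xs (eq ∘ there))

concatMap-↭ : ∀ {X Y : Set} {f g : X → List Y} xs → (∀ x → f x ↭ g x) → concatMap f xs ↭ concatMap g xs
concatMap-↭ []       _  = ↭.refl
concatMap-↭ (x ∷ xs) eq = ++⁺ (eq x) (concatMap-↭ xs eq)

-- Edges of a complete tiered graph from u to the larger vertices of a later tier W.
ascending : ℕ → List ℕ → List Edge
ascending u W = concatMap (λ v → if u <ᵇ v then (u , v) ∷ [] else []) W

ascending-∈ : ∀ u W {c d} → (c , d) ∈ ascending u W → c ≡ u × d ∈ W
ascending-∈ u (v ∷ W) i with u <ᵇ v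
ascending-∈ u (v ∷ W) (here refl) | true  = refl , here refl
ascending-∈ u (v ∷ W) (there i)   | true  = Product.map₂ there (ascending-∈ u W i)
ascending-∈ u (v ∷ W) i           | false = Product.map₂ there (ascending-∈ u W i)

ascending-++ : ∀ u W W′ → ascending u (W ++ W′) ≡ ascending u W ++ ascending u W′
ascending-++ u = concatMap-++ (λ v → if u <ᵇ v then (u , v) ∷ [] else [])

map-ascending : ∀ (φ : ℕ → ℕ) u W → (∀ {v} → v ∈ W → (u <ᵇ v) ≡ (φ u <ᵇ φ v)) →
                map (mapEdge φ) (ascending u W) ≡ ascending (φ u) (map φ W)
map-ascending φ u []      _    = refl
map-ascending φ u (v ∷ W) same rewrite same (here refl) with φ u <ᵇ φ v
... | true  = cong (_ ∷_) (map-ascending φ u W (same ∘ there))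
... | false = map-ascending φ u W (same ∘ there)

map-ascending-fixing : ∀ (f : ℕ → ℕ) u W → f u ≡ u → (∀ {m} → m ∈ W → f m ≡ m) →
                       map (mapEdge f) (ascending u W) ≡ ascending u W
map-ascending-fixing f u W fu fW =
  trans (map-ascending f u W (λ m∈W → cong₂ _<ᵇ_ (sym fu) (sym (fW m∈W))))
        (cong₂ ascending fu (map-id-local (All.tabulate fW)))

map-ascending-moving : ∀ (f : ℕ → ℕ) u x x′ → f u ≡ u → f x ≡ x′ → (u <ᵇ x) ≡ (u <ᵇ x′) →
                       map (mapEdge f) (ascending u (x ∷ [])) ≡ ascending u (x′ ∷ [])
map-ascending-moving f u x x′ fu fx same =
  trans (map-ascending f u (x ∷ []) λ { (here refl) → trans same (cong₂ _<ᵇ_ (sym fu) (sym fx)) })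
        (cong₂ (λ v w → ascending v (w ∷ [])) fu fx)

ctEdges-endpoints : ∀ Us {c d} → (c , d) ∈ ctEdges Us → c ∈ concat Us × d ∈ concat Us
ctEdges-endpoints (U ∷ Us) i with ∈-++⁻ (concatMap (λ u → concatMap (ascending u) Us) U) i
... | inj₂ j = Product.map (∈-++⁺ʳ U) (∈-++⁺ʳ U) (ctEdges-endpoints Us j)
... | inj₁ j with find (concatMap⁻ (λ u → concatMap (ascending u) Us) {xs = U} j)
...   | u , u∈U , k with find (concatMap⁻ (ascending u) {xs = Us} k)
...     | W , W∈Us , l with ascending-∈ u W l
...       | refl , d∈W = ∈-++⁺ˡ u∈U , ∈-++⁺ʳ U (∈-concat⁺′ d∈W W∈Us)

concatMap-nil : ∀ {X Y : Set} (xs : List X) → concatMap (λ _ → []) xs ≡ [] {A = Y}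
concatMap-nil []       = refl
concatMap-nil (_ ∷ xs) = concatMap-nil xs

ctEdges-pair : ∀ P Q → ctEdges (P ∷ Q ∷ []) ≡ concatMap (λ u → ascending u Q) P
ctEdges-pair P Q = begin
  concatMap (λ u → ascending u Q ++ []) P ++ (concatMap (λ _ → []) Q ++ [])
    ≡⟨ cong₂ _++_ (concatMap-cong (λ u → ++-identityʳ (ascending u Q)) P)
                  (trans (++-identityʳ _) (concatMap-nil Q)) ⟩
  concatMap (λ u → ascending u Q) P ++ []
    ≡⟨ ++-identityʳ _ ⟩
  concatMap (λ u → ascending u Q) P ∎

ctEdges-snoc-pair : ∀ X Y a b → ctEdges ((X ++ a ∷ []) ∷ (Y ++ b ∷ []) ∷ []) ≡
  concatMap (λ u → ascending u Y ++ ascending u (b ∷ [])) X ++ (ascending a Y ++ ascending a (b ∷ []))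
ctEdges-snoc-pair X Y a b = begin
  ctEdges ((X ++ a ∷ []) ∷ (Y ++ b ∷ []) ∷ [])
    ≡⟨ ctEdges-pair (X ++ a ∷ []) (Y ++ b ∷ []) ⟩
  concatMap (λ u → ascending u (Y ++ b ∷ [])) (X ++ a ∷ [])
    ≡⟨ concatMap-++ (λ u → ascending u (Y ++ b ∷ [])) X (a ∷ []) ⟩
  concatMap (λ u → ascending u (Y ++ b ∷ [])) X ++ (ascending a (Y ++ b ∷ []) ++ [])
    ≡⟨ cong₂ _++_ (concatMap-cong (λ u → ascending-++ u Y (b ∷ [])) X)
                  (trans (++-identityʳ _) (ascending-++ a Y (b ∷ []))) ⟩
  concatMap (λ u → ascending u Y ++ ascending u (b ∷ [])) X ++ (ascending a Y ++ ascending a (b ∷ [])) ∎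

ctEdges-triple : ∀ X a Y → ctEdges (X ∷ (a ∷ []) ∷ Y ∷ []) ≡
  concatMap (λ u → ascending u (a ∷ []) ++ ascending u Y) X ++ ascending a Y
ctEdges-triple X a Y =
  cong₂ _++_ (concatMap-cong (λ u → cong (ascending u (a ∷ []) ++_) (++-identityʳ (ascending u Y))) X)
             (trans (ctEdges-pair (a ∷ []) Y) (++-identityʳ (ascending a Y)))

transpose : ℕ → ℕ → ℕ → ℕ
transpose a b v with v ≟ a | v ≟ b
... | yes _ | _     = b
... | no _  | yes _ = a
... | no _  | no _  = v

merge : ℕ → ℕ → ℕ → ℕ
merge a b v with v ≟ b
... | yes _ = a
... | no _  = v

transpose-fst : ∀ a b → transpose a b a ≡ b
transpose-fst a b with a ≟ a
... | yes _  = refl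
... | no a≢a = contradiction refl a≢a

transpose-snd : ∀ {a b} → a ≢ b → transpose a b b ≡ a
transpose-snd {a} {b} a≢b with b ≟ a | b ≟ b
... | yes b≡a | _      = contradiction (sym b≡a) a≢b
... | no _    | yes _  = refl
... | no _    | no b≢b = contradiction refl b≢b

transpose-other : ∀ {a b v} → v ≢ a → v ≢ b → transpose a b v ≡ v
transpose-other {a} {b} {v} v≢a v≢b with v ≟ a | v ≟ b
... | yes v≡a | _       = contradiction v≡a v≢a
... | no _    | yes v≡b = contradiction v≡b v≢b
... | no _    | no _    = refl

transpose-involutive : ∀ {a b} → a ≢ b → ∀ v → transpose a b (transpose a b v) ≡ v
transpose-involutive {a} {b} a≢b v with v ≟ a | v ≟ b
... | yes refl | _        = transpose-snd a≢b
... | no _     | yes refl = transpose-fst a b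
... | no v≢a   | no v≢b   = transpose-other v≢a v≢b

transpose-injective : ∀ {a b} → a ≢ b → ∀ {v w} → transpose a b v ≡ transpose a b w → v ≡ w
transpose-injective a≢b {v} {w} eq =
  trans (sym (transpose-involutive a≢b v)) (trans (cong (transpose _ _) eq) (transpose-involutive a≢b w))

merge-snd : ∀ a b → merge a b b ≡ a
merge-snd a b with b ≟ b
... | yes _  = refl
... | no b≢b = contradiction refl b≢b

merge-other : ∀ {a b v} → v ≢ b → merge a b v ≡ v
merge-other {a} {b} {v} v≢b with v ≟ b
... | yes v≡b = contradiction v≡b v≢b
... | no _    = refl

<ᵇ-suc : ∀ u r → u ≢ r → (u <ᵇ suc r) ≡ (u <ᵇ r)
<ᵇ-suc zero    zero    u≢r = contradiction refl u≢r
<ᵇ-suc zero    (suc r) _   = refl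
<ᵇ-suc (suc u) zero    _   = refl
<ᵇ-suc (suc u) (suc r) u≢r = <ᵇ-suc u r (u≢r ∘ cong suc)

suc-<ᵇ : ∀ r v → v ≢ suc r → (suc r <ᵇ v) ≡ (r <ᵇ v)
suc-<ᵇ r       zero          _   = refl
suc-<ᵇ zero    (suc zero)    v≢s = contradiction refl v≢s
suc-<ᵇ zero    (suc (suc v)) _   = refl
suc-<ᵇ (suc r) (suc v)       v≢s = suc-<ᵇ r v (v≢s ∘ cong suc)

<ᵇ-step : ∀ r → (r <ᵇ suc r) ≡ true
<ᵇ-step zero    = refl
<ᵇ-step (suc r) = <ᵇ-step r

step-<ᵇ : ∀ r → (suc r <ᵇ r) ≡ false
step-<ᵇ zero    = refl
step-<ᵇ (suc r) = step-<ᵇ r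

module ThreeGraphs (r : ℕ) (U₁ U₂ : List ℕ) (unique₁ : Unique U₁) (unique₂ : Unique U₂)
  (disjoint : ∀ {m} → m ∈ U₁ → m ∉ U₂)
  (avoids : ∀ {m} → m ∈ U₁ ⊎ m ∈ U₂ → m ≢ r × m ≢ suc r) where

  s : ℕ
  s = suc r

  r≢s : r ≢ s
  r≢s = ℕP.1+n≢n ∘ sym

  ψ φ : ℕ → ℕ
  ψ = transpose r s
  φ = merge r s

  G₀ G₁ G₂ : Graph
  G₀ = CT (U₁ ∷ (r ∷ []) ∷ U₂ ∷ [])
  G₁ = CT ((U₁ ++ r ∷ []) ∷ (U₂ ++ s ∷ []) ∷ [])
  G₂ = CT ((U₁ ++ s ∷ []) ∷ (U₂ ++ r ∷ []) ∷ [])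

  V₀ V₁ V₂ : List ℕ
  V₀ = vertices G₀
  V₁ = vertices G₁
  V₂ = vertices G₂

  avoids₁ : ∀ {m} → m ∈ U₁ → m ≢ r × m ≢ s
  avoids₁ = avoids ∘ inj₁

  avoids₂ : ∀ {m} → m ∈ U₂ → m ≢ r × m ≢ s
  avoids₂ = avoids ∘ inj₂

  ψ-fixes : ∀ {m} → m ∈ U₁ ⊎ m ∈ U₂ → ψ m ≡ m
  ψ-fixes m∈ = transpose-other (proj₁ (avoids m∈)) (proj₂ (avoids m∈))

  φ-fixes : ∀ {m} → m ∈ U₁ ⊎ m ∈ U₂ → φ m ≡ m
  φ-fixes m∈ = merge-other (proj₂ (avoids m∈))

  ∈V₀⁻ : ∀ {m} → m ∈ V₀ → m ∈ U₁ ⊎ m ≡ r ⊎ m ∈ U₂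
  ∈V₀⁻ m∈ with ∈-concat⁻′ (U₁ ∷ (r ∷ []) ∷ U₂ ∷ []) m∈
  ... | _ , m∈U₁ , here refl                 = inj₁ m∈U₁
  ... | _ , here m≡r , there (here refl)     = inj₂ (inj₁ m≡r)
  ... | _ , there ()  , there (here refl)
  ... | _ , m∈U₂ , there (there (here refl)) = inj₂ (inj₂ m∈U₂)

  r∈V₀ : r ∈ V₀
  r∈V₀ = ∈-++⁺ʳ U₁ (here refl)

  s∉V₀ : s ∉ V₀
  s∉V₀ s∈ with ∈V₀⁻ s∈
  ... | inj₁ s∈U₁        = proj₂ (avoids₁ s∈U₁) refl
  ... | inj₂ (inj₁ s≡r) = r≢s (sym s≡r)
  ... | inj₂ (inj₂ s∈U₂) = proj₂ (avoids₂ s∈U₂) refl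

  φ-fixes-V₀ : ∀ {m} → m ∈ V₀ → φ m ≡ m
  φ-fixes-V₀ m∈ = merge-other λ { refl → s∉V₀ m∈ }

  uniqueV₀ : Unique V₀
  uniqueV₀ = Unique.concat⁺ (unique₁ ∷ ([] ∷ []) ∷ unique₂ ∷ [])
    (((λ { (r∈U₁ , here refl) → proj₁ (avoids₁ r∈U₁) refl })
      ∷ (λ (m∈U₁ , m∈U₂) → disjoint m∈U₁ m∈U₂) ∷ [])
    ∷ ((λ { (here refl , r∈U₂) → proj₁ (avoids₂ r∈U₂) refl }) ∷ []) ∷ [] ∷ [])

  V₁≡V₀+s : V₁ ≡ V₀ ++ s ∷ []
  V₁≡V₀+s = begin
    (U₁ ++ r ∷ []) ++ ((U₂ ++ s ∷ []) ++ [])   ≡⟨ ++-assoc U₁ (r ∷ []) _ ⟩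
    U₁ ++ r ∷ ((U₂ ++ s ∷ []) ++ [])           ≡⟨ cong (λ L → U₁ ++ r ∷ L) (trans (++-identityʳ _)
                                                      (cong (_++ s ∷ []) (sym (++-identityʳ U₂)))) ⟩
    U₁ ++ r ∷ ((U₂ ++ []) ++ s ∷ [])           ≡⟨ ++-assoc U₁ (r ∷ (U₂ ++ [])) (s ∷ []) ⟨
    V₀ ++ s ∷ [] ∎

  ψV₂≡V₁ : map ψ V₂ ≡ V₁
  ψV₂≡V₁ = begin
    map ψ ((U₁ ++ s ∷ []) ++ ((U₂ ++ r ∷ []) ++ []))
      ≡⟨ map-++ ψ (U₁ ++ s ∷ []) _ ⟩
    map ψ (U₁ ++ s ∷ []) ++ map ψ ((U₂ ++ r ∷ []) ++ [])
      ≡⟨ cong₂ _++_ (tier U₁ s inj₁) (trans (map-++ ψ (U₂ ++ r ∷ []) []) (cong (_++ []) (tier U₂ r inj₂))) ⟩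
    (U₁ ++ ψ s ∷ []) ++ ((U₂ ++ ψ r ∷ []) ++ [])
      ≡⟨ cong₂ (λ a b → (U₁ ++ a ∷ []) ++ ((U₂ ++ b ∷ []) ++ [])) (transpose-snd r≢s) (transpose-fst r s) ⟩
    (U₁ ++ r ∷ []) ++ ((U₂ ++ s ∷ []) ++ []) ∎
    where
    tier : ∀ U x → (∀ {m} → m ∈ U → m ∈ U₁ ⊎ m ∈ U₂) → map ψ (U ++ x ∷ []) ≡ U ++ ψ x ∷ []
    tier U x in-tiers = trans (map-++ ψ U (x ∷ []))
                              (cong (_++ ψ x ∷ []) (map-id-local (All.tabulate (ψ-fixes ∘ in-tiers))))

  uniqueV₁ : Unique V₁
  uniqueV₁ = subst Unique (sym V₁≡V₀+s) (unique-snoc uniqueV₀ s∉V₀)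

  uniqueV₂ : Unique V₂
  uniqueV₂ = Unique.map⁻ (subst Unique (sym ψV₂≡V₁) uniqueV₁)

  r∈V₁ : r ∈ V₁
  r∈V₁ = ∈-++⁺ˡ (∈-++⁺ʳ U₁ (here refl))

  r∈V₂ : r ∈ V₂
  r∈V₂ = ∈-++⁺ʳ (U₁ ++ s ∷ []) (∈-++⁺ˡ (∈-++⁺ʳ U₂ (here refl)))

  E₀ E₁ E₂ : List Edge
  E₀ = edges G₀
  E₁ = edges G₁
  E₂ = edges G₂

  e : Edge
  e = r , s

  fromU₁ : ℕ → List Edge
  fromU₁ x = concatMap (λ u → ascending u U₂ ++ ascending u (x ∷ [])) U₁

  E₁′ : List Edge
  E₁′ = fromU₁ s ++ ascending r U₂

  r-to-s : ascending r (s ∷ []) ≡ e ∷ []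
  r-to-s rewrite <ᵇ-step r = refl

  s-to-r : ascending s (r ∷ []) ≡ []
  s-to-r rewrite step-<ᵇ r = refl

  E₁↭ : E₁ ↭ e ∷ E₁′
  E₁↭ = subst (_↭ e ∷ E₁′) (sym E₁≡) (++-comm E₁′ (e ∷ []))
    where
    E₁≡ : E₁ ≡ E₁′ ++ e ∷ []
    E₁≡ = begin
      E₁
        ≡⟨ ctEdges-snoc-pair U₁ U₂ r s ⟩
      fromU₁ s ++ (ascending r U₂ ++ ascending r (s ∷ []))
        ≡⟨ cong (λ L → fromU₁ s ++ (ascending r U₂ ++ L)) r-to-s ⟩
      fromU₁ s ++ (ascending r U₂ ++ e ∷ [])
        ≡⟨ ++-assoc (fromU₁ s) (ascending r U₂) (e ∷ []) ⟨
      E₁′ ++ e ∷ [] ∎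

  relabel-fromU₁ : ∀ (f : ℕ → ℕ) x x′ → (∀ {m} → m ∈ U₁ ⊎ m ∈ U₂ → f m ≡ m) → f x ≡ x′ →
                   (∀ {u} → u ∈ U₁ → (u <ᵇ x) ≡ (u <ᵇ x′)) → map (mapEdge f) (fromU₁ x) ≡ fromU₁ x′
  relabel-fromU₁ f x x′ fixes fx same =
    trans (map-concatMap (mapEdge f) _ U₁) (concatMap-cong-∈ U₁ λ {u} u∈U₁ →
      trans (map-++ (mapEdge f) (ascending u U₂) (ascending u (x ∷ [])))
            (cong₂ _++_ (map-ascending-fixing f u U₂ (fixes (inj₁ u∈U₁)) (fixes ∘ inj₂))
                        (map-ascending-moving f u x x′ (fixes (inj₁ u∈U₁)) fx (same u∈U₁))))

  -- Deleting e from G₁ gives G₂ up to the swap ψ.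
  ψE₂≡E₁′ : map (mapEdge ψ) E₂ ≡ E₁′
  ψE₂≡E₁′ = begin
    map (mapEdge ψ) E₂                                              ≡⟨ cong (map (mapEdge ψ)) E₂≡ ⟩
    map (mapEdge ψ) (fromU₁ r ++ ascending s U₂)                    ≡⟨ map-++ (mapEdge ψ) (fromU₁ r) _ ⟩
    map (mapEdge ψ) (fromU₁ r) ++ map (mapEdge ψ) (ascending s U₂) ≡⟨ cong₂ _++_ from-U₁ from-s ⟩
    E₁′                                                             ∎
    where
    E₂≡ : E₂ ≡ fromU₁ r ++ ascending s U₂
    E₂≡ = trans (ctEdges-snoc-pair U₁ U₂ s r)
                (cong (fromU₁ r ++_) (trans (cong (ascending s U₂ ++_) s-to-r) (++-identityʳ _)))

    from-U₁ : map (mapEdge ψ) (fromU₁ r) ≡ fromU₁ s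
    from-U₁ = relabel-fromU₁ ψ r s ψ-fixes (transpose-fst r s)
                (λ u∈U₁ → sym (<ᵇ-suc _ r (proj₁ (avoids₁ u∈U₁))))

    from-s : map (mapEdge ψ) (ascending s U₂) ≡ ascending r U₂
    from-s = trans (map-ascending ψ s U₂ s-vs-U₂)
                   (cong₂ ascending (transpose-snd r≢s) (map-id-local (All.tabulate (ψ-fixes ∘ inj₂))))
      where
      s-vs-U₂ : ∀ {v} → v ∈ U₂ → (s <ᵇ v) ≡ (ψ s <ᵇ ψ v)
      s-vs-U₂ v∈U₂ = trans (suc-<ᵇ r _ (proj₂ (avoids₂ v∈U₂)))
                           (cong₂ _<ᵇ_ (sym (transpose-snd r≢s)) (sym (ψ-fixes (inj₂ v∈U₂))))

  -- Contracting e in G₁ gives G₀ up to the order of the edges.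
  E₀↭φE₁′ : E₀ ↭ map (mapEdge φ) E₁′
  E₀↭φE₁′ = subst₂ _↭_ (sym (ctEdges-triple U₁ r U₂)) (sym φE₁′≡)
    (++⁺ʳ (ascending r U₂) (concatMap-↭ U₁ λ u → ++-comm (ascending u (r ∷ [])) (ascending u U₂)))
    where
    φE₁′≡ : map (mapEdge φ) E₁′ ≡ fromU₁ r ++ ascending r U₂
    φE₁′≡ = trans (map-++ (mapEdge φ) (fromU₁ s) (ascending r U₂))
      (cong₂ _++_ (relabel-fromU₁ φ s r φ-fixes (merge-snd r s)
                                  (λ u∈U₁ → <ᵇ-suc _ r (proj₁ (avoids₁ u∈U₁))))
                  (map-ascending-fixing φ r U₂ (merge-other r≢s) (φ-fixes ∘ inj₂)))

  E₁′-endpoints : ∀ {B} → B ∈ sublists E₁′ →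
                  ∀ {c d} → (c , d) ∈ B → c ∈ V₀ ++ s ∷ [] × d ∈ V₀ ++ s ∷ []
  E₁′-endpoints B∈ cd∈B = subst (λ V → _ ∈ V × _ ∈ V) V₁≡V₀+s
    (ctEdges-endpoints ((U₁ ++ r ∷ []) ∷ (U₂ ++ s ∷ []) ∷ [])
      (∈-resp-↭ (↭-sym E₁↭) (there (sublists-⊆ E₁′ B∈ cd∈B))))

  E₂-endpoints : ∀ {C} → C ∈ sublists E₂ → ∀ {c d} → (c , d) ∈ C → c ∈ V₂ × d ∈ V₂
  E₂-endpoints C∈ = ctEdges-endpoints ((U₁ ++ s ∷ []) ∷ (U₂ ++ r ∷ []) ∷ []) ∘ sublists-⊆ E₂ C∈

  -- The spanning subgraphs of G₁ containing e contribute T^c(G₀) ...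
  contraction-sum : ∀ y → Σ⊆ E₁′ (weight V₁ y ∘ (e ∷_)) ≡ tutteᶜ G₀ y
  contraction-sum y = begin
    Σ⊆ E₁′ (weight V₁ y ∘ (e ∷_))
      ≡⟨ sum-cong (sublists E₁′) contract ⟩
    Σ⊆ E₁′ (weight V₀ y ∘ map (mapEdge φ))
      ≡⟨ Σ⊆-map (weight V₀ y) (mapEdge φ) E₁′ ⟨
    Σ⊆ (map (mapEdge φ) E₁′) (weight V₀ y)
      ≡⟨ Σ⊆-↭ (weight V₀ y) E₀↭φE₁′ (weight-↭ V₀ y r∈V₀ uniqueV₀) ⟨
    Σ⊆ E₀ (weight V₀ y)
      ≡⟨ tutteᶜ-expansion V₀ E₀ y r∈V₀ uniqueV₀ ⟨
    tutteᶜ G₀ y ∎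
    where
    contract : ∀ {B} → B ∈ sublists E₁′ → weight V₁ y (e ∷ B) ≡ weight V₀ y (map (mapEdge φ) B)
    contract {B} B∈ = trans (cong (λ V → weight V y (e ∷ B)) V₁≡V₀+s)
      (sym (Contraction.weight-contract φ V₀ B r∈V₀ s∉V₀ φ-fixes-V₀ (merge-snd r s) (E₁′-endpoints B∈)
                                        y uniqueV₀))

  -- ... and those avoiding e contribute T^c(G₂).
  deletion-sum : ∀ y → Σ⊆ E₁′ (weight V₁ y) ≡ tutteᶜ G₂ y
  deletion-sum y = begin
    Σ⊆ E₁′ (weight V₁ y)                   ≡⟨ cong (λ E → Σ⊆ E (weight V₁ y)) ψE₂≡E₁′ ⟨
    Σ⊆ (map (mapEdge ψ) E₂) (weight V₁ y)  ≡⟨ Σ⊆-map (weight V₁ y) (mapEdge ψ) E₂ ⟩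
    Σ⊆ E₂ (weight V₁ y ∘ map (mapEdge ψ))  ≡⟨ sum-cong (sublists E₂) relabel ⟩
    Σ⊆ E₂ (weight V₂ y)                    ≡⟨ tutteᶜ-expansion V₂ E₂ y r∈V₂ uniqueV₂ ⟨
    tutteᶜ G₂ y                            ∎
    where
    relabel : ∀ {C} → C ∈ sublists E₂ → weight V₁ y (map (mapEdge ψ) C) ≡ weight V₂ y C
    relabel {C} C∈ = trans (cong (λ V → weight V y (map (mapEdge ψ) C)) (sym ψV₂≡V₁))
      (weight-relabel ψ V₂ C y (transpose-injective r≢s) r∈V₂ uniqueV₂ (E₂-endpoints C∈))

  deletion-contraction : ∀ y → tutteᶜ G₁ y ≡ tutteᶜ G₀ y ℤ.+ tutteᶜ G₂ y
  deletion-contraction y = begin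
    tutteᶜ G₁ y
      ≡⟨ tutteᶜ-expansion V₁ E₁ y r∈V₁ uniqueV₁ ⟩
    Σ⊆ E₁ (weight V₁ y)
      ≡⟨ Σ⊆-↭ (weight V₁ y) E₁↭ (weight-↭ V₁ y r∈V₁ uniqueV₁) ⟩
    Σ⊆ (e ∷ E₁′) (weight V₁ y)
      ≡⟨ Σ⊆-∷ (weight V₁ y) e E₁′ ⟩
    Σ⊆ E₁′ (weight V₁ y ∘ (e ∷_)) ℤ.+ Σ⊆ E₁′ (weight V₁ y)
      ≡⟨ cong₂ ℤ._+_ (contraction-sum y) (deletion-sum y) ⟩
    tutteᶜ G₀ y ℤ.+ tutteᶜ G₂ y ∎

solve-difference : ∀ {a b c : ℤ} → b ≡ a ℤ.+ c → a ≡ b - c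
solve-difference {a} {b} {c} b≡a+c = begin
  a                   ≡⟨ ℤP.+-identityʳ a ⟨
  a ℤ.+ + 0           ≡⟨ cong (λ z → a ℤ.+ z) (ℤP.+-inverseʳ c) ⟨
  a ℤ.+ (c - c)       ≡⟨ ℤP.+-assoc a c (ℤ.- c) ⟨
  (a ℤ.+ c) - c       ≡⟨ cong (_- c) b≡a+c ⟨
  b - c               ∎

-- Lemma 5.1: deletion–contraction solved for T^c(G₀), after rewriting r + 1 as suc r.
lemma5p1 : (n r : ℕ) (U₁ U₂ : List ℕ) →
    1 ≤ n → 1 ≤ r → r ≤ n + 1 →
    U₁ ≢ [] → U₂ ≢ [] → Unique U₁ → Unique U₂ →
    (∀ m → m ∈ U₁ → m ∉ U₂) →
    (∀ m → (m ∈ U₁ ⊎ m ∈ U₂) ⇔ (1 ≤ m × m ≤ n + 2 × m ≢ r × m ≢ r + 1)) →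
    (y : ℤ) →
    tutteᶜ (CT (U₁ ∷ (r ∷ []) ∷ U₂ ∷ [])) y
      ≡ tutteᶜ (CT ((U₁ ++ r ∷ []) ∷ (U₂ ++ (r + 1) ∷ []) ∷ [])) y
        - tutteᶜ (CT ((U₁ ++ (r + 1) ∷ []) ∷ (U₂ ++ r ∷ []) ∷ [])) y
lemma5p1 n r U₁ U₂ _ _ _ _ _ unique₁ unique₂ disjoint partition y rewrite ℕP.+-comm r 1 =
  solve-difference (ThreeGraphs.deletion-contraction r U₁ U₂ unique₁ unique₂ (disjoint _) avoids y)
  where
  avoids : ∀ {m} → m ∈ U₁ ⊎ m ∈ U₂ → m ≢ r × m ≢ suc r
  avoids {m} m∈ with Equivalence.to (partition m) m∈
  ... | _ , _ , m≢r , m≢r+1 = m≢r , m≢r+1
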